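{- Let $\vdash$ be either classical or intuitionistic propositional derivability. If a formula $A$ is both $E_1$-projective and $E_2$-projective, where $E_1,E_2\in\mathcal{L}({\sf par})$, then $\vdash E_1\leftrightarrow E_2$.
   Context: The language $\mathcal{L}$ is built from atoms ${\sf var}\cup{\sf par}$ (variables and parameters, disjoint infinite sets) using $\bot,\wedge,\vee,\to$. $\mathcal{L}({\sf par})$ is the set of formulas whose atoms are all parameters. A substitution is a map $\theta:\mathcal{L}\to\mathcal{L}$ commuting with connectives with $\theta(p)=p$ for $p\in{\sf par}$. For $E\in\mathcal{L}({\sf par})$, $A$ is $E$-projective if there is a substitution $\theta$ with $A\vdash\theta(a)\leftrightarrow a$ for every atom $a$ and $\vdash\theta(A)\leftrightarrow E$. -}

module Defs where

open import Data.Nat using (ℕ)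
open import Data.List using (List; []; _∷_)
open import Data.List.Membership.Propositional using (_∈_)
open import Data.Product using (Σ; _×_)

data Atom : Set where
  var : ℕ → Atom
  par : ℕ → Atom

infixr 6 _∧'_
infixr 5 _∨'_
infixr 4 _⇒_
data Fm : Set where
  at   : Atom → Fm
  ⊥'   : Fm
  _∧'_ : Fm → Fm → Fm
  _∨'_ : Fm → Fm → Fm
  _⇒_  : Fm → Fm → Fm

¬' : Fm → Fm
¬' A = A ⇒ ⊥'

_⇔_ : Fm → Fm → Fm
A ⇔ B = (A ⇒ B) ∧' (B ⇒ A)

-- E ∈ L(par): every atom occurring in E is a parameter.
data ParOnly : Fm → Set where
  po-par : ∀ n → ParOnly (at (par n))
  po-⊥   : ParOnly ⊥'
  po-∧   : ∀ {A B} → ParOnly A → ParOnly B → ParOnly (A ∧' B)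
  po-∨   : ∀ {A B} → ParOnly A → ParOnly B → ParOnly (A ∨' B)
  po-⇒   : ∀ {A B} → ParOnly A → ParOnly B → ParOnly (A ⇒ B)

data Logic : Set where
  int cl : Logic

infix 2 _⊢[_]_
data _⊢[_]_ : List Fm → Logic → Fm → Set where
  hyp  : ∀ {Γ L A} → A ∈ Γ → Γ ⊢[ L ] A
  ⊥E   : ∀ {Γ L A} → Γ ⊢[ L ] ⊥' → Γ ⊢[ L ] A
  ∧I   : ∀ {Γ L A B} → Γ ⊢[ L ] A → Γ ⊢[ L ] B → Γ ⊢[ L ] A ∧' B
  ∧E₁  : ∀ {Γ L A B} → Γ ⊢[ L ] A ∧' B → Γ ⊢[ L ] A
  ∧E₂  : ∀ {Γ L A B} → Γ ⊢[ L ] A ∧' B → Γ ⊢[ L ] B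
  ∨I₁  : ∀ {Γ L A B} → Γ ⊢[ L ] A → Γ ⊢[ L ] A ∨' B
  ∨I₂  : ∀ {Γ L A B} → Γ ⊢[ L ] B → Γ ⊢[ L ] A ∨' B
  ∨E   : ∀ {Γ L A B C} → Γ ⊢[ L ] A ∨' B → (A ∷ Γ) ⊢[ L ] C → (B ∷ Γ) ⊢[ L ] C
         → Γ ⊢[ L ] C
  ⇒I   : ∀ {Γ L A B} → (A ∷ Γ) ⊢[ L ] B → Γ ⊢[ L ] A ⇒ B
  ⇒E   : ∀ {Γ L A B} → Γ ⊢[ L ] A ⇒ B → Γ ⊢[ L ] A → Γ ⊢[ L ] B
  lem  : ∀ {Γ A} → Γ ⊢[ cl ] A ∨' ¬' A

-- A substitution commutes with the connectives and fixes parameters, so it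
-- is determined by its values on variables.
Subst : Set
Subst = ℕ → Fm

applyAt : Subst → Atom → Fm
applyAt θ (var n) = θ n
applyAt θ (par n) = at (par n)

apply : Subst → Fm → Fm
apply θ (at a)   = applyAt θ a
apply θ ⊥'       = ⊥'
apply θ (A ∧' B) = apply θ A ∧' apply θ B
apply θ (A ∨' B) = apply θ A ∨' apply θ B
apply θ (A ⇒ B)  = apply θ A ⇒ apply θ B

Projective : Logic → Fm → Fm → Set
Projective L E A =
  Σ Subst λ θ →
    ((a : Atom) → (A ∷ []) ⊢[ L ] apply θ (at a) ⇔ at a)
    × ([] ⊢[ L ] apply θ A ⇔ E)

-- If θ witnesses that A is E-projective, then A ⊢ θ(A) ↔ A and ⊢ θ(A) ↔ E give
-- A ⊢ E.  Applying a second unifier θ₂ of A (for E₂) turns A ⊢ E₁ into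
-- θ₂(A) ⊢ θ₂(E₁) = E₁, and E₂ ⊢ θ₂(A); hence E₂ ⊢ E₁, and E₁ ⊢ E₂ by symmetry.
module Submission where

open import Defs
open import Data.List using ([]; _∷_; List; map)
open import Data.List.Relation.Unary.Any using (here; there)
open import Data.List.Relation.Binary.Subset.Propositional using (_⊆_)
open import Data.List.Relation.Binary.Subset.Propositional.Properties using (∷⁺ʳ; xs⊆x∷xs)
open import Data.List.Membership.Propositional.Properties using (∈-map⁺)
open import Data.Product using (_,_)
open import Relation.Binary.PropositionalEquality using (_≡_; refl; cong₂; subst)

private
  variable
    Γ Δ : List Fm
    L : Logic
    A A′ B B′ E E₁ E₂ : Fm

weaken : Γ ⊆ Δ → Γ ⊢[ L ] B → Δ ⊢[ L ] B
weaken Γ⊆Δ (hyp x)    = hyp (Γ⊆Δ x)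
weaken Γ⊆Δ (⊥E d)     = ⊥E (weaken Γ⊆Δ d)
weaken Γ⊆Δ (∧I d e)   = ∧I (weaken Γ⊆Δ d) (weaken Γ⊆Δ e)
weaken Γ⊆Δ (∧E₁ d)    = ∧E₁ (weaken Γ⊆Δ d)
weaken Γ⊆Δ (∧E₂ d)    = ∧E₂ (weaken Γ⊆Δ d)
weaken Γ⊆Δ (∨I₁ d)    = ∨I₁ (weaken Γ⊆Δ d)
weaken Γ⊆Δ (∨I₂ d)    = ∨I₂ (weaken Γ⊆Δ d)
weaken Γ⊆Δ (∨E d e f) = ∨E (weaken Γ⊆Δ d) (weaken (∷⁺ʳ _ Γ⊆Δ) e) (weaken (∷⁺ʳ _ Γ⊆Δ) f)
weaken Γ⊆Δ (⇒I d)     = ⇒I (weaken (∷⁺ʳ _ Γ⊆Δ) d)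
weaken Γ⊆Δ (⇒E d e)   = ⇒E (weaken Γ⊆Δ d) (weaken Γ⊆Δ e)
weaken Γ⊆Δ lem        = lem

weaken₁ : Γ ⊢[ L ] B → (A ∷ Γ) ⊢[ L ] B
weaken₁ = weaken (xs⊆x∷xs _ _)

weaken₂ : Γ ⊢[ L ] B → (A ∷ A′ ∷ Γ) ⊢[ L ] B
weaken₂ d = weaken₁ (weaken₁ d)

weaken-closed : [] ⊢[ L ] B → Γ ⊢[ L ] B
weaken-closed = weaken (λ ())

head-hyp : (A ∷ Γ) ⊢[ L ] A
head-hyp = hyp (here refl)

cut : (A ∷ []) ⊢[ L ] B → Γ ⊢[ L ] A → Γ ⊢[ L ] B
cut d a = ⇒E (weaken-closed (⇒I d)) a

⊢-apply : ∀ θ → Γ ⊢[ L ] B → map (apply θ) Γ ⊢[ L ] apply θ B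
⊢-apply θ (hyp x)    = hyp (∈-map⁺ (apply θ) x)
⊢-apply θ (⊥E d)     = ⊥E (⊢-apply θ d)
⊢-apply θ (∧I d e)   = ∧I (⊢-apply θ d) (⊢-apply θ e)
⊢-apply θ (∧E₁ d)    = ∧E₁ (⊢-apply θ d)
⊢-apply θ (∧E₂ d)    = ∧E₂ (⊢-apply θ d)
⊢-apply θ (∨I₁ d)    = ∨I₁ (⊢-apply θ d)
⊢-apply θ (∨I₂ d)    = ∨I₂ (⊢-apply θ d)
⊢-apply θ (∨E d e f) = ∨E (⊢-apply θ d) (⊢-apply θ e) (⊢-apply θ f)
⊢-apply θ (⇒I d)     = ⇒I (⊢-apply θ d)
⊢-apply θ (⇒E d e)   = ⇒E (⊢-apply θ d) (⊢-apply θ e)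
⊢-apply θ lem        = lem

apply-parOnly : ∀ θ → ParOnly E → apply θ E ≡ E
apply-parOnly θ (po-par n) = refl
apply-parOnly θ po-⊥       = refl
apply-parOnly θ (po-∧ p q) = cong₂ _∧'_ (apply-parOnly θ p) (apply-parOnly θ q)
apply-parOnly θ (po-∨ p q) = cong₂ _∨'_ (apply-parOnly θ p) (apply-parOnly θ q)
apply-parOnly θ (po-⇒ p q) = cong₂ _⇒_ (apply-parOnly θ p) (apply-parOnly θ q)

⇔-refl : Γ ⊢[ L ] A ⇔ A
⇔-refl = ∧I (⇒I head-hyp) (⇒I head-hyp)

⇔-∧-cong : Γ ⊢[ L ] A ⇔ A′ → Γ ⊢[ L ] B ⇔ B′ → Γ ⊢[ L ] (A ∧' B) ⇔ (A′ ∧' B′)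
⇔-∧-cong a b = ∧I (map-∧ (∧E₁ a) (∧E₁ b)) (map-∧ (∧E₂ a) (∧E₂ b))
  where
    map-∧ : ∀ {X X′ Y Y′} → Γ ⊢[ L ] X ⇒ X′ → Γ ⊢[ L ] Y ⇒ Y′ → Γ ⊢[ L ] (X ∧' Y) ⇒ (X′ ∧' Y′)
    map-∧ f g = ⇒I (∧I (⇒E (weaken₁ f) (∧E₁ head-hyp)) (⇒E (weaken₁ g) (∧E₂ head-hyp)))

⇔-∨-cong : Γ ⊢[ L ] A ⇔ A′ → Γ ⊢[ L ] B ⇔ B′ → Γ ⊢[ L ] (A ∨' B) ⇔ (A′ ∨' B′)
⇔-∨-cong a b = ∧I (map-∨ (∧E₁ a) (∧E₁ b)) (map-∨ (∧E₂ a) (∧E₂ b))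
  where
    map-∨ : ∀ {X X′ Y Y′} → Γ ⊢[ L ] X ⇒ X′ → Γ ⊢[ L ] Y ⇒ Y′ → Γ ⊢[ L ] (X ∨' Y) ⇒ (X′ ∨' Y′)
    map-∨ f g = ⇒I (∨E head-hyp (∨I₁ (⇒E (weaken₂ f) head-hyp)) (∨I₂ (⇒E (weaken₂ g) head-hyp)))

⇔-⇒-cong : Γ ⊢[ L ] A ⇔ A′ → Γ ⊢[ L ] B ⇔ B′ → Γ ⊢[ L ] (A ⇒ B) ⇔ (A′ ⇒ B′)
⇔-⇒-cong a b = ∧I (map-⇒ (∧E₂ a) (∧E₁ b)) (map-⇒ (∧E₁ a) (∧E₂ b))
  where
    map-⇒ : ∀ {X X′ Y Y′} → Γ ⊢[ L ] X′ ⇒ X → Γ ⊢[ L ] Y ⇒ Y′ → Γ ⊢[ L ] (X ⇒ Y) ⇒ (X′ ⇒ Y′)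
    map-⇒ f g = ⇒I (⇒I (⇒E (weaken₂ g) (⇒E (hyp (there (here refl))) (⇒E (weaken₂ f) head-hyp))))

apply-⇔ : ∀ θ → (∀ a → Γ ⊢[ L ] apply θ (at a) ⇔ at a) → ∀ B → Γ ⊢[ L ] apply θ B ⇔ B
apply-⇔ θ atoms (at a)   = atoms a
apply-⇔ θ atoms ⊥'       = ⇔-refl
apply-⇔ θ atoms (B ∧' C) = ⇔-∧-cong (apply-⇔ θ atoms B) (apply-⇔ θ atoms C)
apply-⇔ θ atoms (B ∨' C) = ⇔-∨-cong (apply-⇔ θ atoms B) (apply-⇔ θ atoms C)
apply-⇔ θ atoms (B ⇒ C)  = ⇔-⇒-cong (apply-⇔ θ atoms B) (apply-⇔ θ atoms C)

projective⇒entails : Projective L E A → (A ∷ []) ⊢[ L ] E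
projective⇒entails {A = A} (θ , atoms , θA⇔E) =
  ⇒E (∧E₁ (weaken-closed θA⇔E)) (⇒E (∧E₂ (apply-⇔ θ atoms A)) head-hyp)

projective-projection-entails : ParOnly E₁ → Projective L E₁ A → Projective L E₂ A
  → (E₂ ∷ []) ⊢[ L ] E₁
projective-projection-entails {E₁ = E₁} {L = L} {E₂ = E₂} par₁ P₁ (θ₂ , _ , θ₂A⇔E₂) =
  subst ((E₂ ∷ []) ⊢[ L ]_) (apply-parOnly θ₂ par₁)
    (cut (⊢-apply θ₂ (projective⇒entails P₁)) (⇒E (∧E₂ (weaken-closed θ₂A⇔E₂)) head-hyp))

lemma2p1 : (L : Logic) (A E₁ E₂ : Fm) → ParOnly E₁ → ParOnly E₂
    → Projective L E₁ A → Projective L E₂ A → [] ⊢[ L ] E₁ ⇔ E₂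
lemma2p1 L A E₁ E₂ par₁ par₂ P₁ P₂ =
  ∧I (⇒I (projective-projection-entails par₂ P₂ P₁))
     (⇒I (projective-projection-entails par₁ P₁ P₂))
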